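{- An unsigned graph $\mathcal{G}$ is (isomorphic to) the Gremban expansion of some signed graph if and only if it has a fixed-point-free involutive automorphism $\eta$ such that, for every edge $(u,v)\in E(\mathcal{G})$, we have $v\neq\eta(u)$ and $(u,\eta(v))\notin E(\mathcal{G})$.
   Context: Graphs are finite, undirected, without loops or multi-edges. A signed graph $G=(V,E,\sigma)$ has a sign function $\sigma:E\to\{\pm1\}$. The Gremban expansion of $G$ is the unsigned graph with node set $\{v^+,v^-:v\in V\}$ and edge set $\{(u^\chi,v^{\chi\cdot\sigma(u,v)}):(u,v)\in E,\ \chi\in\{\pm\}\}$. An automorphism is a bijection of nodes preserving adjacency and non-adjacency. -}

module Defs where

open import Data.Bool using (Bool; true; false; _∧_; not; _xor_)
open import Data.Nat using (ℕ)
open import Data.Fin using (Fin)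
open import Data.Product using (_×_; _,_; Σ; ∃; ∃-syntax)
open import Function.Bundles using (_↔_; Inverse)
open import Relation.Binary.PropositionalEquality using (_≡_; refl)
open import Relation.Nullary using (¬_)

record Graph (V : Set) : Set where
  field
    Adj    : V → V → Bool
    sym    : ∀ u v → Adj u v ≡ Adj v u
    irrefl : ∀ u → Adj u u ≡ false
open Graph public

-- Signs ±1 encoded as Bool: true = +1, false = -1.
Sign : Set
Sign = Bool

_·_ : Sign → Sign → Sign
s · t = not (s xor t)

_==_ : Sign → Sign → Bool
s == t = not (s xor t)

-- A signed graph on vertex set Fin m: an underlying graph plus a sign
-- function on (unordered) pairs; only its values on edges matter.
record SignedGraph (m : ℕ) : Set where
  field
    graph  : Graph (Fin m)
    σ      : Fin m → Fin m → Sign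
    σ-sym  : ∀ u v → σ u v ≡ σ v u
open SignedGraph public

-- Gremban expansion: node set {v^+, v^-} = Fin m × Sign; (u^χ, w^χ') is an edge
-- iff (u,w) ∈ E and χ' = χ · σ(u,w).
GAdj : ∀ {m} → SignedGraph m → Fin m × Sign → Fin m × Sign → Bool
GAdj S (u , χ) (w , χ') = Adj (graph S) u w ∧ (χ' == (χ · σ S u w))

private
  lemma : ∀ a χ χ' s → a ∧ (χ' == (χ · s)) ≡ a ∧ (χ == (χ' · s))
  lemma false _ _ _ = refl
  lemma true false false false = refl
  lemma true false false true = refl
  lemma true false true false = refl
  lemma true false true true = refl
  lemma true true false false = refl
  lemma true true false true = refl
  lemma true true true false = refl
  lemma true true true true = refl

  GAdj-sym : ∀ {m} (S : SignedGraph m) x y → GAdj S x y ≡ GAdj S y x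
  GAdj-sym S (u , χ) (w , χ')
    rewrite sym (graph S) u w | σ-sym S u w = lemma (Adj (graph S) w u) χ χ' (σ S w u)

  GAdj-irr : ∀ {m} (S : SignedGraph m) x → GAdj S x x ≡ false
  GAdj-irr S (u , χ) rewrite irrefl (graph S) u = refl

Gremban : ∀ {m} → SignedGraph m → Graph (Fin m × Sign)
Gremban S = record { Adj = GAdj S ; sym = GAdj-sym S ; irrefl = GAdj-irr S }

Isomorphism : ∀ {V W} → Graph V → Graph W → Set
Isomorphism {V} {W} G H =
  Σ (V ↔ W) λ f → ∀ u v → Adj G u v ≡ Adj H (Inverse.to f u) (Inverse.to f v)

Isomorphic : ∀ {V W} → Graph V → Graph W → Set
Isomorphic G H = Isomorphism G H

Automorphism : ∀ {V} → Graph V → Set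
Automorphism G = Isomorphism G G

IsGrembanExpansion : ∀ {n} → Graph (Fin n) → Set
IsGrembanExpansion G = ∃[ m ] Σ (SignedGraph m) λ S → Isomorphic G (Gremban S)

HasGrembanInvolution : ∀ {V} → Graph V → Set
HasGrembanInvolution {V} G =
  Σ (Automorphism G) λ (η , _) →
    let e = Inverse.to η in
    (∀ u → e (e u) ≡ u) ×
    (∀ u → ¬ (e u ≡ u)) ×
    (∀ u v → Adj G u v ≡ true → ¬ (v ≡ e u) × Adj G u (e v) ≡ false)

-- Negating the sign of every node, v^χ ↦ v^(-χ), is an involution of a Gremban expansion with the
-- required properties, and these properties transfer along isomorphisms. Conversely, given such an
-- involution η, pick one representative r in every orbit {u, η u} (here: the smaller node) and
-- identify r with r^+ and η r with r^-. On representatives put an edge r—s iff r ~ s or r ~ η s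
-- (the edge conditions on η make these exclusive), with sign + in the first case and - in the second.
module Submission where

open import Defs hiding (sym)
open import Data.Bool using (Bool; true; false; _∧_; _∨_; not; if_then_else_)
open import Data.Nat using (ℕ; zero; suc; _+_)
open import Data.Fin using (Fin; zero; suc; _<_)
open import Data.Fin.Properties using (+↔⊎; _<?_; <-irrelevant; <-asym; <-cmp)
open import Data.Product using (_×_; _,_; Σ; ∃-syntax; proj₁; proj₂)
open import Data.Product.Function.NonDependent.Propositional using (_×-↔_)
open import Data.Sum using (_⊎_; inj₁; inj₂)
open import Data.Sum.Function.Propositional using (_⊎-↔_)
open import Data.Empty using (⊥-elim)
open import Function using (_∘_)
open import Function.Bundles using (_↔_; Inverse; mk↔ₛ′)
open import Function.Properties.Inverse using (↔-refl; ↔-sym; ↔-trans)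
open import Relation.Binary using (tri<; tri≈; tri>)
open import Relation.Binary.PropositionalEquality
  using (_≡_; refl; sym; trans; cong; cong₂; subst)
open import Relation.Nullary using (¬_; Dec; yes; no; contradiction)
import Relation.Nullary as Nullary
open import Relation.Unary using (Decidable; Irrelevant)

open Inverse using (to; from; strictlyInverseˡ; strictlyInverseʳ)

involution↔ : ∀ {A : Set} (f : A → A) → (∀ x → f (f x) ≡ x) → A ↔ A
involution↔ f f-invol = mk↔ₛ′ f f f-invol f-invol

Σ-irrelevant-≡ : ∀ {A : Set} {P : A → Set} → Irrelevant P →
                 ∀ {u v} → u ≡ v → (p : P u) (q : P v) → (u , p) ≡ (v , q)
Σ-irrelevant-≡ P-irr refl p q = cong (_ ,_) (P-irr p q)

Isomorphism-sym : ∀ {V W} {G : Graph V} {H : Graph W} → Isomorphism H G → Isomorphism G H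
Isomorphism-sym {G = G} {H} (φ , φ-pres) = ↔-sym φ , λ u v → sym (from-pres u v)
  where
  from-pres : ∀ u v → Adj H (from φ u) (from φ v) ≡ Adj G u v
  from-pres u v = trans (φ-pres (from φ u) (from φ v))
                  (cong₂ (Adj G) (strictlyInverseˡ φ u) (strictlyInverseˡ φ v))

HasGrembanInvolution-transport : ∀ {V W} {G : Graph V} {H : Graph W} →
  Isomorphism G H → HasGrembanInvolution H → HasGrembanInvolution G
HasGrembanInvolution-transport {V} {W} {G} {H} (φ , φ-pres) ((η↔ , η-aut) , η-invol , η-fpf , η-edge) =
  (involution↔ η′ η′-invol , η′-aut) , η′-invol , η′-fpf , η′-edge
  where
  η : W → W
  η = to η↔

  η′ : V → V
  η′ = from φ ∘ η ∘ to φ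

  to-η′ : ∀ u → to φ (η′ u) ≡ η (to φ u)
  to-η′ u = strictlyInverseˡ φ (η (to φ u))

  η′-invol : ∀ u → η′ (η′ u) ≡ u
  η′-invol u = trans (cong (from φ ∘ η) (to-η′ u))
                     (trans (cong (from φ) (η-invol (to φ u))) (strictlyInverseʳ φ u))

  Adj-η′ : ∀ u v → Adj G u (η′ v) ≡ Adj H (to φ u) (η (to φ v))
  Adj-η′ u v = trans (φ-pres u (η′ v)) (cong (Adj H (to φ u)) (to-η′ v))

  η′-aut : ∀ u v → Adj G u v ≡ Adj G (η′ u) (η′ v)
  η′-aut u v = trans (φ-pres u v) (trans (η-aut (to φ u) (to φ v))
    (sym (trans (φ-pres (η′ u) (η′ v)) (cong₂ (Adj H) (to-η′ u) (to-η′ v)))))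

  η′-fpf : ∀ u → ¬ (η′ u ≡ u)
  η′-fpf u η′u≡u = η-fpf (to φ u) (trans (sym (to-η′ u)) (cong (to φ) η′u≡u))

  η′-edge : ∀ u v → Adj G u v ≡ true → ¬ (v ≡ η′ u) × Adj G u (η′ v) ≡ false
  η′-edge u v uv = (λ v≡η′u → proj₁ edge (trans (cong (to φ) v≡η′u) (to-η′ u)))
                 , trans (Adj-η′ u v) (proj₂ edge)
    where edge = η-edge (to φ u) (to φ v) (trans (sym (φ-pres u v)) uv)

negate : ∀ {m} → Fin m × Sign → Fin m × Sign
negate (a , χ) = a , not χ

negate-involutive : ∀ {m} (x : Fin m × Sign) → negate (negate x) ≡ x
negate-involutive (a , false) = refl
negate-involutive (a , true)  = refl

==-·-not : ∀ χ χ′ s → (not χ′ == (not χ · s)) ≡ (χ′ == (χ · s))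
==-·-not false false false = refl
==-·-not false false true  = refl
==-·-not false true  false = refl
==-·-not false true  true  = refl
==-·-not true  false false = refl
==-·-not true  false true  = refl
==-·-not true  true  false = refl
==-·-not true  true  true  = refl

∧-==-not : ∀ a χ t → a ∧ (χ == t) ≡ true → a ∧ (not χ == t) ≡ false
∧-==-not true  false false _ = refl
∧-==-not true  true  true  _ = refl
∧-==-not true  false true  ()
∧-==-not true  true  false ()
∧-==-not false _     _     ()

Gremban-involution : ∀ {m} (S : SignedGraph m) → HasGrembanInvolution (Gremban S)
Gremban-involution S =
  (involution↔ negate negate-involutive , negate-aut) , negate-involutive , negate-fpf , negate-edge
  where
  negate-aut : ∀ x y → GAdj S x y ≡ GAdj S (negate x) (negate y)
  negate-aut (a , χ) (b , χ′) = sym (cong (Adj (graph S) a b ∧_) (==-·-not χ χ′ (σ S a b)))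

  negate-fpf : ∀ x → ¬ (negate x ≡ x)
  negate-fpf (a , false) ()
  negate-fpf (a , true)  ()

  no-edge-to-negation : ∀ x → GAdj S x (negate x) ≡ false
  no-edge-to-negation (a , χ) rewrite irrefl (graph S) a = refl

  negate-edge : ∀ x y → GAdj S x y ≡ true → ¬ (y ≡ negate x) × GAdj S x (negate y) ≡ false
  negate-edge (a , χ) (b , χ′) xy =
      (λ { refl → contradiction (trans (sym xy) (no-edge-to-negation (a , χ))) λ () })
    , ∧-==-not (Adj (graph S) a b) χ′ (χ · σ S a b) xy

IsGrembanExpansion⇒HasGrembanInvolution : ∀ {n} (G : Graph (Fin n)) →
  IsGrembanExpansion G → HasGrembanInvolution G
IsGrembanExpansion⇒HasGrembanInvolution G (m , S , φ) =
  HasGrembanInvolution-transport {G = G} {H = Gremban S} φ (Gremban-involution S)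

Dec-irrelevant↔Fin : ∀ {A : Set} → Dec A → Nullary.Irrelevant A → ∃[ k ] (Fin k ↔ A)
Dec-irrelevant↔Fin (yes a) A-irr = 1 , mk↔ₛ′ (λ _ → a) (λ _ → zero) (A-irr a) λ { zero → refl ; (suc ()) }
Dec-irrelevant↔Fin (no ¬a) _     = 0 , mk↔ₛ′ (λ ()) (⊥-elim ∘ ¬a) (⊥-elim ∘ ¬a) λ ()

Σ-Fin-suc↔ : ∀ {n} (P : Fin (suc n) → Set) → Σ (Fin (suc n)) P ↔ (P zero ⊎ Σ (Fin n) (P ∘ suc))
Σ-Fin-suc↔ P = mk↔ₛ′ split join split-join join-split
  where
  split : Σ _ P → P zero ⊎ Σ _ (P ∘ suc)
  split (zero  , p) = inj₁ p
  split (suc i , p) = inj₂ (i , p)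

  join : P zero ⊎ Σ _ (P ∘ suc) → Σ _ P
  join (inj₁ p)       = zero , p
  join (inj₂ (i , p)) = suc i , p

  split-join : ∀ y → split (join y) ≡ y
  split-join (inj₁ p) = refl
  split-join (inj₂ y) = refl

  join-split : ∀ x → join (split x) ≡ x
  join-split (zero  , p) = refl
  join-split (suc i , p) = refl

enumerate : ∀ {n} {P : Fin n → Set} → Decidable P → Irrelevant P → ∃[ k ] (Fin k ↔ Σ (Fin n) P)
enumerate {zero} _ _ = 0 , mk↔ₛ′ (λ ()) (λ { (() , _) }) (λ { (() , _) }) λ ()
enumerate {suc n} {P} P? P-irr =
  let j , Fin-j↔ = Dec-irrelevant↔Fin (P? zero) P-irr
      k , Fin-k↔ = enumerate (P? ∘ suc) P-irr
  in j + k , ↔-trans (+↔⊎ {j}) (↔-trans (Fin-j↔ ⊎-↔ Fin-k↔) (↔-sym (Σ-Fin-suc↔ P)))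

module Orbits {V : Set} (η : V → V) (η-invol : ∀ u → η (η u) ≡ u)
  {P : V → Set} (P? : Decidable P) (P-irr : Irrelevant P)
  (¬P⇒Pη : ∀ u → ¬ P u → P (η u)) (P⇒¬Pη : ∀ u → P u → ¬ P (η u)) where

  unfold : Σ V P × Sign → V
  unfold ((r , _) , true)  = r
  unfold ((r , _) , false) = η r

  fold : V → Σ V P × Sign
  fold u with P? u
  ... | yes p  = (u , p) , true
  ... | no ¬p  = (η u , ¬P⇒Pη u ¬p) , false

  unfold-fold : ∀ u → unfold (fold u) ≡ u
  unfold-fold u with P? u
  ... | yes _ = refl
  ... | no _  = η-invol u

  fold-unfold : ∀ x → fold (unfold x) ≡ x
  fold-unfold ((r , p) , true) with P? r
  ... | yes p′ = cong (λ q → (r , q) , true) (P-irr p′ p)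
  ... | no ¬p  = contradiction p ¬p
  fold-unfold ((r , p) , false) with P? (η r)
  ... | yes pη = contradiction pη (P⇒¬Pη r p)
  ... | no ¬pη = cong (_, false) (Σ-irrelevant-≡ P-irr (η-invol r) (¬P⇒Pη (η r) ¬pη) p)

  orbits↔ : (Σ V P × Sign) ↔ V
  orbits↔ = mk↔ₛ′ unfold fold unfold-fold fold-unfold

module SignedQuotient {V : Set} (G : Graph V) (η : V → V)
  (η-aut : ∀ u v → Adj G u v ≡ Adj G (η u) (η v)) (η-invol : ∀ u → η (η u) ≡ u)
  (η-edge : ∀ u v → Adj G u v ≡ true → ¬ (v ≡ η u) × Adj G u (η v) ≡ false)
  {k : ℕ} (ρ : Fin k → V) where

  A : V → V → Bool
  A = Adj G

  Adj-η-sym : ∀ u v → A u (η v) ≡ A v (η u)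
  Adj-η-sym u v = trans (η-aut u (η v))
    (trans (cong (A (η u)) (η-invol v)) (Graph.sym G (η u) v))

  Adj-η-self : ∀ u → A u (η u) ≡ false
  Adj-η-self u with A u (η u) in uηu
  ... | true  = contradiction refl (proj₁ (η-edge u (η u) uηu))
  ... | false = refl

  quotient : Graph (Fin k)
  quotient = record
    { Adj    = λ i j → A (ρ i) (ρ j) ∨ A (ρ i) (η (ρ j))
    ; sym    = λ i j → cong₂ _∨_ (Graph.sym G (ρ i) (ρ j)) (Adj-η-sym (ρ i) (ρ j))
    ; irrefl = λ i → cong₂ _∨_ (Graph.irrefl G (ρ i)) (Adj-η-self (ρ i))
    }

  signedQuotient : SignedGraph k
  signedQuotient = record
    { graph = quotient ; σ = λ i j → A (ρ i) (ρ j) ; σ-sym = λ i j → Graph.sym G (ρ i) (ρ j) }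

  lift : Fin k × Sign → V
  lift (i , true)  = ρ i
  lift (i , false) = η (ρ i)

  Adj-lift-select : ∀ i j χ χ′ →
    A (lift (i , χ)) (lift (j , χ′)) ≡ (if χ == χ′ then A (ρ i) (ρ j) else A (ρ i) (η (ρ j)))
  Adj-lift-select i j true  true  = refl
  Adj-lift-select i j true  false = refl
  Adj-lift-select i j false true  = trans (Graph.sym G (η (ρ i)) (ρ j)) (Adj-η-sym (ρ j) (ρ i))
  Adj-lift-select i j false false = sym (η-aut (ρ i) (ρ j))

  select-sign : ∀ a b χ χ′ → (a ≡ true → b ≡ false) →
    (if χ == χ′ then a else b) ≡ (a ∨ b) ∧ (χ′ == (χ · a))
  select-sign true  true  _     _     a⇒¬b with () ← a⇒¬b refl
  select-sign true  false true  true  _ = refl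
  select-sign true  false true  false _ = refl
  select-sign true  false false true  _ = refl
  select-sign true  false false false _ = refl
  select-sign false true  true  true  _ = refl
  select-sign false true  true  false _ = refl
  select-sign false true  false true  _ = refl
  select-sign false true  false false _ = refl
  select-sign false false true  true  _ = refl
  select-sign false false true  false _ = refl
  select-sign false false false true  _ = refl
  select-sign false false false false _ = refl

  Adj-lift : ∀ x y → A (lift x) (lift y) ≡ GAdj signedQuotient x y
  Adj-lift (i , χ) (j , χ′) = trans (Adj-lift-select i j χ χ′)
    (select-sign _ _ χ χ′ λ ρiρj → proj₂ (η-edge (ρ i) (ρ j) ρiρj))

HasGrembanInvolution⇒IsGrembanExpansion : ∀ {n} (G : Graph (Fin n)) →
  HasGrembanInvolution G → IsGrembanExpansion G
HasGrembanInvolution⇒IsGrembanExpansion {n} G ((η↔ , η-aut) , η-invol , η-fpf , η-edge) =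
  k , signedQuotient , Isomorphism-sym {G = G} {H = Gremban signedQuotient} (φ , λ x y → sym (φ-pres x y))
  where
  η : Fin n → Fin n
  η = to η↔

  Lower : Fin n → Set
  Lower u = u < η u

  ¬Lower⇒Lowerη : ∀ u → ¬ Lower u → Lower (η u)
  ¬Lower⇒Lowerη u ¬u<ηu with <-cmp u (η u)
  ... | tri< u<ηu _ _    = contradiction u<ηu ¬u<ηu
  ... | tri≈ _ u≡ηu _    = contradiction (sym u≡ηu) (η-fpf u)
  ... | tri> _ _ ηu<u    = subst (η u <_) (sym (η-invol u)) ηu<u

  Lower⇒¬Lowerη : ∀ u → Lower u → ¬ Lower (η u)
  Lower⇒¬Lowerη u u<ηu ηu<ηηu = <-asym u<ηu (subst (η u <_) (η-invol u) ηu<ηηu)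

  open Orbits η η-invol (λ u → u <? η u) <-irrelevant ¬Lower⇒Lowerη Lower⇒¬Lowerη

  enumeration : ∃[ k ] (Fin k ↔ Σ (Fin n) Lower)
  enumeration = enumerate (λ u → u <? η u) <-irrelevant

  k : ℕ
  k = proj₁ enumeration

  Fin-k↔Lower : Fin k ↔ Σ (Fin n) Lower
  Fin-k↔Lower = proj₂ enumeration

  open SignedQuotient G η η-aut η-invol η-edge (λ i → proj₁ (to Fin-k↔Lower i))

  φ : (Fin k × Sign) ↔ Fin n
  φ = ↔-trans (Fin-k↔Lower ×-↔ ↔-refl) orbits↔

  to-φ : ∀ x → to φ x ≡ lift x
  to-φ (i , true)  = refl
  to-φ (i , false) = refl

  φ-pres : ∀ x y → Adj G (to φ x) (to φ y) ≡ GAdj signedQuotient x y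
  φ-pres x y = trans (cong₂ (Adj G) (to-φ x) (to-φ y)) (Adj-lift x y)

proposition5 : ∀ (n : ℕ) (G : Graph (Fin n)) →
    (IsGrembanExpansion G → HasGrembanInvolution G) × (HasGrembanInvolution G → IsGrembanExpansion G)
proposition5 n G = IsGrembanExpansion⇒HasGrembanInvolution G , HasGrembanInvolution⇒IsGrembanExpansion G
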